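{- For every positive integer $n$, $\mathrm{MOF}(K_n) \leq \mathrm{MOF}(K_{n+1}) \leq \mathrm{MOF}(K_n) +1$.
   Context: An orientation of a simple graph $G$ assigns to each edge $\{u,v\}$ exactly one of the arcs $(u,v)$ or $(v,u)$; if $(u,v)$ is an arc, $v$ is an out-neighbor of $u$. Oriented forcing: given an orientation $D$ and a set $S$ of initially colored vertices, any colored vertex having at most $1$ non-colored out-neighbor forces that out-neighbor to become colored; this rule is applied iteratively as long as possible. $S$ is a forcing set of $D$ if at the end every vertex is colored. $F(D)$ is the minimum size of a forcing set of $D$, and $\mathrm{MOF}(G)$ is the maximum of $F(D)$ over all orientations $D$ of $G$. $K_n$ is the complete graph on $n$ vertices. -}

module Defs where

open import Data.Nat using (ℕ; suc; _≤_; _+_)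
open import Data.Bool using (Bool; true; false; T; not)
open import Data.Fin using (Fin)
open import Data.Fin.Subset using (Subset; _∈_; ∣_∣)
open import Data.Product using (Σ; _×_; ∃)
open import Data.Sum using (_⊎_)
open import Data.Empty using (⊥)
open import Data.Empty using (⊥-elim)
open import Relation.Nullary using (¬_; does; yes; no)
open import Relation.Binary.PropositionalEquality using (_≡_; _≢_; refl; sym)
open import Data.Fin using (_≟_)

record Graph (n : ℕ) : Set where
  field
    adj   : Fin n → Fin n → Bool
    adj-sym  : ∀ u v → adj u v ≡ adj v u
    loopless : ∀ v → adj v v ≡ false
open Graph public

K : (n : ℕ) → Graph n
K n = record { adj = λ u v → not (isEq u v) ; adj-sym = λ u v → symEq u v ; loopless = λ v → reflEq v }
  where
  isEq : Fin n → Fin n → Bool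
  isEq u v = does (u ≟ v)
  symEq : ∀ u v → not (isEq u v) ≡ not (isEq v u)
  symEq u v with u ≟ v | v ≟ u
  ... | yes _ | yes _ = refl
  ... | no _  | no _  = refl
  ... | yes p | no q = ⊥-elim (q (sym p))
  ... | no p  | yes q = ⊥-elim (p (sym q))
  reflEq : ∀ v → not (isEq v v) ≡ false
  reflEq v with v ≟ v
  ... | yes _ = refl
  ... | no ¬p = ⊥-elim (¬p refl)

record Orientation {n : ℕ} (G : Graph n) : Set where
  field
    arc        : Fin n → Fin n → Bool
    arc⇒edge   : ∀ u v → T (arc u v) → T (adj G u v)
    edge⇒arc   : ∀ u v → T (adj G u v) → T (arc u v) ⊎ T (arc v u)
    antisym    : ∀ u v → T (arc u v) → T (arc v u) → ⊥
open Orientation public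

data Colored {n : ℕ} {G : Graph n} (D : Orientation G) (S : Subset n) : Fin n → Set where
  initial : ∀ {v} → v ∈ S → Colored D S v
  force   : ∀ {u v} → Colored D S u → T (arc D u v)
          → (∀ w → T (arc D u w) → w ≢ v → Colored D S w)
          → Colored D S v

IsForcingSet : {n : ℕ} {G : Graph n} → Orientation G → Subset n → Set
IsForcingSet D S = ∀ v → Colored D S v

IsF : {n : ℕ} {G : Graph n} → Orientation G → ℕ → Set
IsF {n} D k = (Σ (Subset n) λ S → IsForcingSet D S × ∣ S ∣ ≡ k)
            × (∀ S → IsForcingSet D S → k ≤ ∣ S ∣)

IsMOF : {n : ℕ} → Graph n → ℕ → Set
IsMOF G m = (Σ (Orientation G) λ D → IsF D m)
          × (∀ (D : Orientation G) k → IsF D k → k ≤ m)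

-- Forcing is decidable: the colored set is the least set
-- containing S that is closed under one round of the forcing rule, and it
-- is reached by saturating S (at most n rounds can add a vertex).  Hence
-- "D has a forcing set of size k" is decidable and F(D) exists as a least
-- element.  Orientations of a graph on Fin n are searchable (they are
-- determined by their n × n arc matrix), so "some orientation has F = k"
-- is decidable and bounded by n, and MOF(G) exists as a greatest element.
--
-- Extending an orientation D of K n by a new sink vertex 0
-- does not lower F: a sink never forces, so dropping it from a forcing
-- set of the extension leaves a forcing set of D.  Conversely, deleting
-- vertex 0 from an orientation D' of K (n+1) and adding 0 to a forcing set
-- of the remainder gives a forcing set of D'.  Applied to optimal
-- orientations these give the two inequalities.

module Submission where

open import Defs
open import Data.Nat using (ℕ; zero; suc; _≤_; _<_; _+_)
open import Data.Nat.Properties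
  using (≤-refl; ≤-trans; ≤-antisym; ≤-reflexive; ≤-pred; +-comm; +-suc;
         +-monoʳ-≤; +-monoˡ-≤; m≤m+n; <-irrefl; ≮⇒≥; ≤∧≢⇒<; n≤0⇒n≡0; m<1+n⇒m<n∨m≡n)
import Data.Nat.Properties as ℕ
open import Data.Bool using (Bool; true; false; T; _∧_)
open import Data.Bool.Properties using (T-∧; T-≡)
open import Data.Unit using (tt)
open import Data.Fin using (Fin; zero; suc; _≟_; _<?_)
open import Data.Fin.Properties using (any?; all?; suc-injective; <-cmp; <-asym)
open import Data.Fin.Subset using (Subset; _∈_; _⊆_; _⊂_; ∣_∣; inside; ⊤)
open import Data.Fin.Subset.Properties
  using (_∈?_; _⊂?_; ⊆-refl; ⊆-trans; anySubset?; p⊂q⇒∣p∣<∣q∣; ∣p∣≤n; ∣p∣≤∣x∷p∣; drop-there; ∈⊤; ∣⊤∣≡n)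
open import Data.Vec using (Vec; []; _∷_; lookup; tabulate; tail; here; there)
open import Data.Vec.Properties using (lookup∘tabulate; lookup⇒[]=; []=⇒lookup)
open import Data.Product using (Σ; _×_; _,_; proj₁; proj₂; ∃)
open import Data.Sum using (_⊎_; inj₁; inj₂) renaming (map to ⊎-map)
open import Data.Empty using (⊥; ⊥-elim)
open import Function.Bundles using (Equivalence)
open import Relation.Binary.Definitions using (tri<; tri≈; tri>)
open import Relation.Nullary using (¬_; Dec; yes; no; does; contradiction)
open import Relation.Nullary.Decidable
  using (_×-dec_; _→-dec_; _⊎-dec_; ¬?; T?; map′; dec-true)
open import Relation.Unary using (Decidable)
open import Relation.Binary.PropositionalEquality
  using (_≡_; _≢_; refl; sym; trans; cong; subst; module ≡-Reasoning)

open Equivalence using (to; from)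

T-does⁺ : ∀ {A : Set} (d : Dec A) → A → T (does d)
T-does⁺ (yes _)  _ = tt
T-does⁺ (no ¬a) a = ¬a a

T-does⁻ : ∀ {A : Set} (d : Dec A) → T (does d) → A
T-does⁻ (yes a) _ = a

subsetOf : ∀ {n} {P : Fin n → Set} → Decidable P → Subset n
subsetOf P? = tabulate (λ x → does (P? x))

∈-subsetOf⁺ : ∀ {n} {P : Fin n → Set} (P? : Decidable P) {x} → P x → x ∈ subsetOf P?
∈-subsetOf⁺ P? {x} px =
  lookup⇒[]= x (subsetOf P?) (trans (lookup∘tabulate _ x) (dec-true (P? x) px))

∈-subsetOf⁻ : ∀ {n} {P : Fin n → Set} (P? : Decidable P) {x} → x ∈ subsetOf P? → P x
∈-subsetOf⁻ P? {x} x∈ =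
  T-does⁻ (P? x) (from T-≡ (trans (sym (lookup∘tabulate _ x)) ([]=⇒lookup x∈)))

-- Saturation.  Iterating an inflationary map on subsets of Fin n while it
-- still grows reaches a fixed point after at most n rounds; every
-- property preserved by the map survives the iteration.

module Saturation {n : ℕ} (step : Subset n → Subset n) (inflationary : ∀ C → C ⊆ step C) where

  saturate : ℕ → Subset n → Subset n
  saturate zero    C = C
  saturate (suc f) C with C ⊂? step C
  ... | yes _ = saturate f (step C)
  ... | no  _ = C

  saturate-preserves : (I : Subset n → Set) → (∀ C → I C → I (step C)) →
                       ∀ f C → I C → I (saturate f C)
  saturate-preserves I pres zero    C i = i
  saturate-preserves I pres (suc f) C i with C ⊂? step C
  ... | yes _ = saturate-preserves I pres f (step C) (pres C i)
  ... | no  _ = i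

  stuck⇒fixed : ∀ C → ¬ (C ⊂ step C) → step C ⊆ C
  stuck⇒fixed C ¬grows {x} x∈step with x ∈? C
  ... | yes x∈C = x∈C
  ... | no  x∉C = ⊥-elim (¬grows (inflationary C , x , x∈step , x∉C))

  saturate-progress : ∀ f C → step (saturate f C) ⊆ saturate f C ⊎ f + ∣ C ∣ ≤ ∣ saturate f C ∣
  saturate-progress zero    C = inj₂ ≤-refl
  saturate-progress (suc f) C with C ⊂? step C
  ... | no ¬grows = inj₁ (stuck⇒fixed C ¬grows)
  ... | yes grows with saturate-progress f (step C)
  ...   | inj₁ fixed = inj₁ fixed
  ...   | inj₂ grown = inj₂ (≤-trans (≤-reflexive (sym (+-suc f ∣ C ∣)))
                                (≤-trans (+-monoʳ-≤ f (p⊂q⇒∣p∣<∣q∣ grows)) grown))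

  saturate-fixed : ∀ C → step (saturate (suc n) C) ⊆ saturate (suc n) C
  saturate-fixed C with saturate-progress (suc n) C
  ... | inj₁ fixed = fixed
  ... | inj₂ grown = ⊥-elim (<-irrefl refl
          (≤-trans (m≤m+n (suc n) ∣ C ∣) (≤-trans grown (∣p∣≤n (saturate (suc n) C)))))

-- Decidability of oriented forcing.  One round of the rule adds every
-- vertex v forced by some colored u; the colored set is the saturation of S.

module ForcingRounds {n} {G : Graph n} (D : Orientation G) where

  Forces : Subset n → Fin n → Fin n → Set
  Forces C u v = u ∈ C × T (arc D u v) × (∀ w → T (arc D u w) → w ≢ v → w ∈ C)

  forces? : ∀ C u v → Dec (Forces C u v)
  forces? C u v = (u ∈? C) ×-dec T? (arc D u v) ×-dec
    all? (λ w → T? (arc D u w) →-dec (¬? (w ≟ v) →-dec (w ∈? C)))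

  Reached : Subset n → Fin n → Set
  Reached C v = v ∈ C ⊎ ∃ λ u → Forces C u v

  reached? : ∀ C → Decidable (Reached C)
  reached? C v = (v ∈? C) ⊎-dec any? (λ u → forces? C u v)

  round : Subset n → Subset n
  round C = subsetOf (reached? C)

  round-inflationary : ∀ C → C ⊆ round C
  round-inflationary C x∈C = ∈-subsetOf⁺ (reached? C) (inj₁ x∈C)

  round-sound : ∀ S C → (∀ {w} → w ∈ C → Colored D S w) → ∀ {w} → w ∈ round C → Colored D S w
  round-sound S C sound w∈ with ∈-subsetOf⁻ (reached? C) w∈
  ... | inj₁ w∈C                    = sound w∈C
  ... | inj₂ (u , u∈C , uv , others) = force (sound u∈C) uv (λ x ux x≢w → sound (others x ux x≢w))

  colored⊆closed : ∀ {S} C → S ⊆ C → round C ⊆ C → ∀ {v} → Colored D S v → v ∈ C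
  colored⊆closed C S⊆C closed (initial v∈S) = S⊆C v∈S
  colored⊆closed C S⊆C closed (force {u} cu uv others) =
    closed (∈-subsetOf⁺ (reached? C) (inj₂ (u , colored⊆closed C S⊆C closed cu , uv ,
      λ w uw w≢v → colored⊆closed C S⊆C closed (others w uw w≢v))))

  open Saturation round round-inflationary

  coloredSet : Subset n → Subset n
  coloredSet S = saturate (suc n) S

  coloredSet-sound : ∀ S {v} → v ∈ coloredSet S → Colored D S v
  coloredSet-sound S =
    saturate-preserves (λ C → ∀ {w} → w ∈ C → Colored D S w) (round-sound S) (suc n) S initial

  coloredSet-complete : ∀ S {v} → Colored D S v → v ∈ coloredSet S
  coloredSet-complete S = colored⊆closed (coloredSet S)
    (saturate-preserves (S ⊆_) (λ C S⊆C → ⊆-trans S⊆C (round-inflationary C)) (suc n) S ⊆-refl)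
    (saturate-fixed S)

  colored? : ∀ S → Decidable (Colored D S)
  colored? S v = map′ (coloredSet-sound S) (coloredSet-complete S) (v ∈? coloredSet S)

  forcingSet? : Decidable (IsForcingSet D)
  forcingSet? S = all? (colored? S)

IsLeast : (ℕ → Set) → ℕ → Set
IsLeast P m = P m × (∀ k → P k → m ≤ k)

IsGreatest : (ℕ → Set) → ℕ → Set
IsGreatest P m = P m × (∀ k → P k → k ≤ m)

searchBelow : {P : ℕ → Set} → Decidable P → ∀ b → (∀ k → k < b → ¬ P k) ⊎ ∃ (IsLeast P)
searchBelow P? zero = inj₁ (λ _ ())
searchBelow {P} P? (suc b) with searchBelow P? b
... | inj₂ least = inj₂ least
... | inj₁ none with P? b
...   | yes pb = inj₂ (b , pb , λ k pk → ≮⇒≥ (λ k<b → none k k<b pk))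
...   | no ¬pb = inj₁ noneUpTo
  where
  noneUpTo : ∀ k → k < suc b → ¬ P k
  noneUpTo k k<1+b with m<1+n⇒m<n∨m≡n k<1+b
  ... | inj₁ k<b  = none k k<b
  ... | inj₂ refl = ¬pb

least : {P : ℕ → Set} → Decidable P → ∀ {m} → P m → ∃ (IsLeast P)
least P? {m} pm with searchBelow P? (suc m)
... | inj₁ none  = contradiction pm (none m ≤-refl)
... | inj₂ least = least

greatest : {P : ℕ → Set} → Decidable P → ∀ {i} → P i → ∀ j → (∀ k → P k → k ≤ j) → ∃ (IsGreatest P)
greatest {P} P? pi zero bound = 0 , subst P (n≤0⇒n≡0 (bound _ pi)) pi , bound
greatest {P} P? pi (suc j) bound with P? (suc j)
... | yes pj = suc j , pj , bound
... | no ¬pj = greatest P? pi j (λ k pk → ≤-pred (≤∧≢⇒< (bound k pk) (λ k≡j → ¬pj (subst P k≡j pk))))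

HasForcingSetOfSize : ∀ {n} {G : Graph n} → Orientation G → ℕ → Set
HasForcingSetOfSize {n} D k = Σ (Subset n) λ S → IsForcingSet D S × ∣ S ∣ ≡ k

-- F(D) exists: the whole vertex set forces, so a least forcing-set size exists.
F-exists : ∀ {n} {G : Graph n} (D : Orientation G) → ∃ (IsF D)
F-exists {n} D = fromLeast (least sized? (⊤ , (λ _ → initial ∈⊤) , ∣⊤∣≡n n))
  where
  open ForcingRounds D
  sized? : Decidable (HasForcingSetOfSize D)
  sized? k = anySubset? (λ S → forcingSet? S ×-dec (∣ S ∣ ℕ.≟ k))
  fromLeast : ∃ (IsLeast (HasForcingSetOfSize D)) → ∃ (IsF D)
  fromLeast (k , smallest , minimal) = k , smallest , λ S forcing → minimal ∣ S ∣ (S , forcing , refl)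

F-unique : ∀ {n} {G : Graph n} {D : Orientation G} {k k′} → IsF D k → IsF D k′ → k ≡ k′
F-unique ((S , forcing , refl) , minimal) ((S′ , forcing′ , refl) , minimal′) =
  ≤-antisym (minimal S′ forcing′) (minimal′ S forcing)

F≤n : ∀ {n} {G : Graph n} {D : Orientation G} {k} → IsF D k → k ≤ n
F≤n {n} (_ , minimal) = ≤-trans (minimal ⊤ (λ _ → initial ∈⊤)) (≤-reflexive (∣⊤∣≡n n))

-- Since F(D) exists and is unique, "F(D) = k" is decidable.
F? : ∀ {n} {G : Graph n} (D : Orientation G) → Decidable (IsF D)
F? D k with F-exists D
... | f , isF = map′ (λ k≡f → subst (IsF D) (sym k≡f) isF) (λ isFk → F-unique isFk isF) (k ℕ.≟ f)

-- Forcing only sees the arcs, so F is invariant under equality of arc relations.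

SameArcs : ∀ {n} {G G′ : Graph n} → Orientation G → Orientation G′ → Set
SameArcs {n} D D′ = ∀ (u v : Fin n) → arc D u v ≡ arc D′ u v

colored-transport : ∀ {n} {G G′ : Graph n} {D : Orientation G} {D′ : Orientation G′} →
                    SameArcs D D′ → ∀ {S v} → Colored D S v → Colored D′ S v
colored-transport same (initial v∈S) = initial v∈S
colored-transport same (force {u} {v} cu uv others) =
  force (colored-transport same cu) (subst T (same u v) uv)
        (λ w uw w≢v → colored-transport same (others w (subst T (sym (same u w)) uw) w≢v))

F-transport : ∀ {n} {G G′ : Graph n} {D : Orientation G} {D′ : Orientation G′} →
              SameArcs D D′ → ∀ {k} → IsF D k → IsF D′ k
F-transport same ((S , forcing , size) , minimal) =
  (S , (λ v → colored-transport same (forcing v)) , size) ,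
  λ S′ forcing′ → minimal S′ (λ v → colored-transport (λ u w → sym (same u w)) (forcing′ v))

Searchable : Set → Set₁
Searchable A = ∀ {P : A → Set} → Decidable P → Dec (∃ P)

searchable-Vec : ∀ {A} → Searchable A → ∀ m → Searchable (Vec A m)
searchable-Vec search zero    P? = map′ ([] ,_) (λ { ([] , p) → p }) (P? [])
searchable-Vec search (suc m) P? =
  map′ (λ { (a , xs , p) → a ∷ xs , p }) (λ { (a ∷ xs , p) → a , xs , p })
       (search (λ a → searchable-Vec search m (λ xs → P? (a ∷ xs))))

module OrientationSearch {n} (G : Graph n) where

  -- An orientation is determined by its arc matrix.
  ArcMatrix : Set
  ArcMatrix = Vec (Subset n) n

  entry : ArcMatrix → Fin n → Fin n → Bool
  entry M u v = lookup (lookup M u) v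

  IsOrientation : ArcMatrix → Set
  IsOrientation M = (∀ u v → T (entry M u v) → T (adj G u v))
                  × (∀ u v → T (adj G u v) → T (entry M u v) ⊎ T (entry M v u))
                  × (∀ u v → T (entry M u v) → T (entry M v u) → ⊥)

  isOrientation? : Decidable IsOrientation
  isOrientation? M = all? (λ u → all? λ v → T? _ →-dec T? _)
             ×-dec all? (λ u → all? λ v → T? _ →-dec (T? _ ⊎-dec T? _))
             ×-dec all? (λ u → all? λ v → T? _ →-dec (T? _ →-dec no (λ ())))

  orientationOf : ∀ M → IsOrientation M → Orientation G
  orientationOf M (a⇒e , e⇒a , anti) =
    record { arc = entry M ; arc⇒edge = a⇒e ; edge⇒arc = e⇒a ; antisym = anti }

  matrixOf : Orientation G → ArcMatrix
  matrixOf D = tabulate (λ u → tabulate (arc D u))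

  entry-matrixOf : ∀ D u v → entry (matrixOf D) u v ≡ arc D u v
  entry-matrixOf D u v = begin
    lookup (lookup (matrixOf D) u) v ≡⟨ cong (λ row → lookup row v) (lookup∘tabulate _ u) ⟩
    lookup (tabulate (arc D u)) v     ≡⟨ lookup∘tabulate _ v ⟩
    arc D u v                         ∎
    where open ≡-Reasoning

  matrixOf-isOrientation : ∀ D → IsOrientation (matrixOf D)
  matrixOf-isOrientation D =
      (λ u v uv → arc⇒edge D u v (fromMatrix uv))
    , (λ u v e → ⊎-map toMatrix toMatrix (edge⇒arc D u v e))
    , (λ u v uv vu → antisym D u v (fromMatrix uv) (fromMatrix vu))
    where
    fromMatrix : ∀ {u v} → T (entry (matrixOf D) u v) → T (arc D u v)
    fromMatrix {u} {v} = subst T (entry-matrixOf D u v)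
    toMatrix : ∀ {u v} → T (arc D u v) → T (entry (matrixOf D) u v)
    toMatrix {u} {v} = subst T (sym (entry-matrixOf D u v))

  -- Every orientation has the same arcs as the one read off its own matrix,
  -- so a property invariant under SameArcs can be searched over matrices.
  anyOrientation? : {P : Orientation G → Set} → (∀ {D D′} → SameArcs D D′ → P D → P D′) →
                    Decidable P → Dec (∃ P)
  anyOrientation? {P} respects P? = map′
    (λ { (M , valid , p) → orientationOf M valid , p })
    (λ { (D , p) → matrixOf D , matrixOf-isOrientation D ,
                   respects (λ u v → sym (entry-matrixOf D u v)) p })
    (searchable-Vec anySubset? n validWith?)
    where
    validWith? : Decidable (λ M → Σ (IsOrientation M) λ valid → P (orientationOf M valid))
    validWith? M with isOrientation? M
    ... | no invalid = no (λ (valid , _) → invalid valid)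
    ... | yes valid  = map′ (valid ,_) (λ (valid′ , p) → respects (λ _ _ → refl) p)
                            (P? (orientationOf M valid))

ascending : ∀ {n} (G : Graph n) → Orientation G
ascending G = record
  { arc      = λ u v → adj G u v ∧ does (u <? v)
  ; arc⇒edge = λ u v uv → proj₁ (to T-∧ uv)
  ; edge⇒arc = edge⇒arc′
  ; antisym  = λ u v uv vu →
      <-asym (T-does⁻ (u <? v) (proj₂ (to T-∧ uv))) (T-does⁻ (v <? u) (proj₂ (to T-∧ vu)))
  }
  where
  edge⇒arc′ : ∀ u v → T (adj G u v) →
              T (adj G u v ∧ does (u <? v)) ⊎ T (adj G v u ∧ does (v <? u))
  edge⇒arc′ u v e with <-cmp u v
  ... | tri< u<v _ _ = inj₁ (from T-∧ (e , T-does⁺ (u <? v) u<v))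
  ... | tri≈ _ refl _ = ⊥-elim (subst T (loopless G u) e)
  ... | tri> _ _ v<u = inj₂ (from T-∧ (subst T (adj-sym G u v) e , T-does⁺ (v <? u) v<u))

Achievable : ∀ {n} → Graph n → ℕ → Set
Achievable G k = Σ (Orientation G) λ D → IsF D k

MOF-exists : ∀ {n} (G : Graph n) → ∃ (IsMOF G)
MOF-exists {n} G = fromGreatest (greatest achievable? someValue n (λ k (_ , isF) → F≤n isF))
  where
  open OrientationSearch G
  achievable? : Decidable (Achievable G)
  achievable? k = anyOrientation? (λ same → F-transport same) (λ D → F? D k)
  someValue : Achievable G (proj₁ (F-exists (ascending G)))
  someValue = ascending G , proj₂ (F-exists (ascending G))
  fromGreatest : ∃ (IsGreatest (Achievable G)) → ∃ (IsMOF G)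
  fromGreatest (m , achieved , maximal) = m , achieved , λ D k isF → maximal k (D , isF)

sinkArc : ∀ {n} → (Fin n → Fin n → Bool) → Fin (suc n) → Fin (suc n) → Bool
sinkArc a zero    _       = false
sinkArc a (suc u) zero    = true
sinkArc a (suc u) (suc v) = a u v

sinkExtend : ∀ {n} → Orientation (K n) → Orientation (K (suc n))
sinkExtend {n} D = record
  { arc = sinkArc (arc D) ; arc⇒edge = arc⇒edge′ ; edge⇒arc = edge⇒arc′ ; antisym = antisym′ }
  where
  arc⇒edge′ : ∀ u v → T (sinkArc (arc D) u v) → T (adj (K (suc n)) u v)
  arc⇒edge′ (suc u) zero    _  = tt
  arc⇒edge′ (suc u) (suc v) uv = arc⇒edge D u v uv
  edge⇒arc′ : ∀ u v → T (adj (K (suc n)) u v) → T (sinkArc (arc D) u v) ⊎ T (sinkArc (arc D) v u)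
  edge⇒arc′ zero    (suc v) _ = inj₂ tt
  edge⇒arc′ (suc u) zero    _ = inj₁ tt
  edge⇒arc′ (suc u) (suc v) e = edge⇒arc D u v e
  antisym′ : ∀ u v → T (sinkArc (arc D) u v) → T (sinkArc (arc D) v u) → ⊥
  antisym′ (suc u) (suc v) = antisym D u v

-- A sink never forces, so a forcing set of the extension minus vertex 0
-- forces D.
colored-dropSink : ∀ {n} (D : Orientation (K n)) {S′ : Subset (suc n)} {v} →
                   Colored (sinkExtend D) S′ (suc v) → Colored D (tail S′) v
colored-dropSink D {_ ∷ _} (initial v∈S′) = initial (drop-there v∈S′)
colored-dropSink D {_ ∷ _} (force {suc u} cu uv others) =
  force (colored-dropSink D cu) uv
        (λ w uw w≢v → colored-dropSink D (others (suc w) uw (λ e → w≢v (suc-injective e))))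

F-sinkExtend : ∀ {n} {D : Orientation (K n)} {a a′} → IsF D a → IsF (sinkExtend D) a′ → a ≤ a′
F-sinkExtend {D = D} (_ , minimal) ((S′ , forcing′ , refl) , _) =
  ≤-trans (minimal (tail S′) (λ v → colored-dropSink D (forcing′ (suc v)))) (∣tail∣≤ S′)
  where
  ∣tail∣≤ : ∀ {n} (S : Subset (suc n)) → ∣ tail S ∣ ≤ ∣ S ∣
  ∣tail∣≤ (s ∷ S) = ∣p∣≤∣x∷p∣ s S

restrict : ∀ {n} → Orientation (K (suc n)) → Orientation (K n)
restrict D = record
  { arc      = λ u v → arc D (suc u) (suc v)
  ; arc⇒edge = λ u v → arc⇒edge D (suc u) (suc v)
  ; edge⇒arc = λ u v → edge⇒arc D (suc u) (suc v)
  ; antisym  = λ u v → antisym D (suc u) (suc v)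
  }

-- With vertex 0 colored from the start, every forcing step of the
-- restriction is a forcing step of D′.
colored-addZero : ∀ {n} (D′ : Orientation (K (suc n))) {S : Subset n} {v} →
                  Colored (restrict D′) S v → Colored D′ (inside ∷ S) (suc v)
colored-addZero D′ (initial v∈S) = initial (there v∈S)
colored-addZero D′ {S} (force {u} {v} cu uv others) = force (colored-addZero D′ cu) uv others′
  where
  others′ : ∀ w → T (arc D′ (suc u) w) → w ≢ suc v → Colored D′ (inside ∷ S) w
  others′ zero    _  _   = initial here
  others′ (suc w) uw w≢v = colored-addZero D′ (others w uw (λ e → w≢v (cong suc e)))

F-restrict : ∀ {n} {D′ : Orientation (K (suc n))} {b c} → IsF D′ b → IsF (restrict D′) c → b ≤ c + 1
F-restrict {D′ = D′} {c = c} (_ , minimal) ((S , forcing , refl) , _) =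
  ≤-trans (minimal (inside ∷ S) forcing′) (≤-reflexive (+-comm 1 c))
  where
  forcing′ : IsForcingSet D′ (inside ∷ S)
  forcing′ zero    = initial here
  forcing′ (suc v) = colored-addZero D′ (forcing v)

MOF-sinkExtend : ∀ {n a b} → IsMOF (K n) a → IsMOF (K (suc n)) b → a ≤ b
MOF-sinkExtend ((D , isF) , _) (_ , maximal) =
  ≤-trans (F-sinkExtend isF isF′) (maximal (sinkExtend D) _ isF′)
  where
  isF′ : IsF (sinkExtend D) (proj₁ (F-exists (sinkExtend D)))
  isF′ = proj₂ (F-exists (sinkExtend D))

MOF-restrict : ∀ {n a b} → IsMOF (K (suc n)) b → IsMOF (K n) a → b ≤ a + 1
MOF-restrict ((D′ , isF) , _) (_ , maximal) =
  ≤-trans (F-restrict isF isF′) (+-monoˡ-≤ 1 (maximal (restrict D′) _ isF′))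
  where
  isF′ : IsF (restrict D′) (proj₁ (F-exists (restrict D′)))
  isF′ = proj₂ (F-exists (restrict D′))

-- The bounds hold for every n.
corollary5 : (n : ℕ) → 1 ≤ n →
    Σ ℕ λ a → Σ ℕ λ b → IsMOF (K n) a × IsMOF (K (suc n)) b × a ≤ b × b ≤ a + 1
corollary5 n _ = compare (MOF-exists (K n)) (MOF-exists (K (suc n)))
  where
  compare : ∃ (IsMOF (K n)) → ∃ (IsMOF (K (suc n))) →
    Σ ℕ λ a → Σ ℕ λ b → IsMOF (K n) a × IsMOF (K (suc n)) b × a ≤ b × b ≤ a + 1
  compare (a , mofA) (b , mofB) = a , b , mofA , mofB , MOF-sinkExtend mofA mofB , MOF-restrict mofB mofA
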